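{- Let $\gamma$ be a positive integer, let $L=(T,V,E)$ be a link stream, and let $\mathcal M$ be a $\gamma$-matching returned by the greedy algorithm $\mathcal A$ applied to $L$. If $\mathcal M'$ is any $\gamma$-matching of $L$, then every $\gamma$-edge of $\mathcal M'$ contains at least one temporal vertex of $\mathtt{bot}(\mathcal M)$.
   Context: A link stream is a triple $L=(T,V,E)$ where $T\subseteq\mathbb N$ is an interval of integers, $V$ is a finite set of vertices, and $E\subseteq T\times\binom{V}{2}$ is a set of timed edges $(t,\{u,v\})$ with $u\neq v$. A temporal vertex is a pair $(t,u)$ with $t\in T$, $u\in V$. For time $t$ and distinct vertices $u,v$, the $\gamma$-edge $\Gamma_\gamma(t,u,v)$ is the set $\{(t',\{u,v\}) : t'\in\{t,\dots,t+\gamma-1\}\}$. A $\gamma$-edge $\Gamma$ contains the temporal vertex $(t,u)$ if $(t,\{u,v\})\in\Gamma$ for some vertex $v$. Two $\gamma$-edges are independent if no temporal vertex is contained in both. A $\gamma$-matching of $L$ is a set of pairwise independent $\gamma$-edges each of which is a subset of $E$. The bottom temporal vertices of a $\gamma$-matching $\mathcal M$ are $\mathtt{bot}(\mathcal M)=\{(t+\gamma-1,u),(t+\gamma-1,v) : \Gamma_\gamma(t,u,v)\in\mathcal M\}$. The greedy algorithm $\mathcal A$: let $\mathcal P$ be the set of all $\gamma$-edges that are subsets of $E$, and fix a total order $\preceq$ on $\mathcal P$ such that $\Gamma_\gamma(t_1,u_1,v_1)\preceq\Gamma_\gamma(t_2,u_2,v_2)$ whenever $t_1<t_2$ (ties broken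 arbitrarily). Starting from $\mathcal M=\emptyset$, scan $\mathcal P$ in increasing $\preceq$ order and add the current $\gamma$-edge $\Gamma$ to $\mathcal M$ if and only if none of the $2\gamma$ temporal vertices contained in $\Gamma$ is contained in a $\gamma$-edge already in $\mathcal M$; return $\mathcal M$. -}

module Defs where

open import Data.Nat using (ℕ; _+_; _∸_; _≤_; _<_)
open import Data.Fin using (Fin)
open import Data.Product using (_×_; ∃; ∃-syntax; _,_)
open import Data.Sum using (_⊎_)
open import Data.Empty using (⊥)
open import Data.List using (List; []; _∷_)
open import Data.List.Membership.Propositional using (_∈_)
open import Data.List.Relation.Unary.Any using (Any)
open import Data.List.Relation.Unary.AllPairs using (AllPairs)
open import Relation.Nullary using (¬_)
open import Relation.Binary.PropositionalEquality using (_≡_)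

-- A link stream L = (T, V, E) with V = Fin n, T = {lo, ..., hi} ⊆ ℕ,
-- and E a set of timed edges given as a predicate E t u v meaning
-- (t, {u,v}) ∈ E (so E must be symmetric in u v and irreflexive).
record LinkStream : Set₁ where
  field
    n      : ℕ
    lo hi  : ℕ
    E      : ℕ → Fin n → Fin n → Set
    E-sym  : ∀ {t u v} → E t u v → E t v u
    E-irr  : ∀ {t u} → ¬ E t u u
    E-inT  : ∀ {t u v} → E t u v → lo ≤ t × t ≤ hi

module _ (γ : ℕ) (L : LinkStream) where
  open LinkStream L

  record GEdge : Set where
    constructor Γ
    field
      start : ℕ
      u v   : Fin n
      u≢v   : ¬ (u ≡ v)
  open GEdge public

  TVertex : Set
  TVertex = ℕ × Fin n

  -- Γ_γ(t,u,v) contains (s,w) iff (s,{w,x}) ∈ Γ for some x,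
  -- i.e. t ≤ s ≤ t+γ-1 and w ∈ {u,v}.
  Contains : GEdge → TVertex → Set
  Contains g (s , w) = (start g ≤ s × s < start g + γ) × (w ≡ u g ⊎ w ≡ v g)

  InE : GEdge → Set
  InE g = ∀ s → start g ≤ s → s < start g + γ → E s (u g) (v g)

  SameGEdge : GEdge → GEdge → Set
  SameGEdge g h = start g ≡ start h ×
    ((u g ≡ u h × v g ≡ v h) ⊎ (u g ≡ v h × v g ≡ u h))

  Independent : GEdge → GEdge → Set
  Independent g h = ¬ (∃[ x ] (Contains g x × Contains h x))

  IsMatching : List GEdge → Set
  IsMatching M = (∀ {g} → g ∈ M → InE g) × AllPairs Independent M

  Bot : List GEdge → TVertex → Set
  Bot M (s , w) = Any (λ g → s ≡ start g + (γ ∸ 1) × (w ≡ u g ⊎ w ≡ v g)) M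

  Blocked : List GEdge → GEdge → Set
  Blocked M g = ∃[ x ] (Contains g x × Any (λ h → Contains h x) M)

  data GreedyRun : List GEdge → List GEdge → List GEdge → Set where
    done : ∀ {M} → GreedyRun [] M M
    add  : ∀ {g P M R} → ¬ Blocked M g → GreedyRun P (g ∷ M) R → GreedyRun (g ∷ P) M R
    skip : ∀ {g P M R} → Blocked M g → GreedyRun P M R → GreedyRun (g ∷ P) M R

  ValidOrder : List GEdge → Set
  ValidOrder P =
      (∀ {g} → g ∈ P → InE g)
    × (∀ g → InE g → Any (SameGEdge g) P)
    × AllPairs (λ g h → ¬ SameGEdge g h) P
    × AllPairs (λ g h → start g ≤ start h) P

  -- M is a γ-matching returned by the greedy algorithm A applied to L
  -- (for some admissible tie-breaking).
  GreedyOutput : List GEdge → Set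
  GreedyOutput M = ∃[ P ] (ValidOrder P × GreedyRun P [] M)

-- The greedy scan visits γ-edges by non-decreasing start time. A γ-edge g ⊆ E
-- is either added, and then its last instant lies in bot(M), or rejected because
-- it shares a temporal vertex (s , w) with an already chosen h, which starts no
-- later than g. In the second case (last h , w) ∈ bot(M), and
-- start g ≤ s ≤ last h < start g + γ shows that g contains it.
module Submission where

open import Defs
open import Data.Nat using (ℕ; suc; _+_; _∸_; _≤_; _<_; s≤s; s≤s⁻¹)
open import Data.Nat.Properties using (≤-refl; ≤-trans; m≤m+n; +-suc; +-monoˡ-≤)
open import Data.Fin using (Fin)
open import Function using (_∘_)
open import Data.Product using (∃-syntax; _×_; _,_; proj₂)
open import Data.Sum using (_⊎_; inj₁; inj₂)
open import Data.List using (List; _∷_)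
open import Data.List.Membership.Propositional using (_∈_; find)
open import Data.List.Relation.Unary.Any as Any using (here; there)
open import Data.List.Relation.Unary.All as All using (All)
open import Data.List.Relation.Unary.AllPairs as AllPairs using (AllPairs)
open import Data.List.Relation.Binary.Subset.Propositional using (_⊆_)
open import Data.List.Relation.Binary.Subset.Propositional.Properties
  using (⊆-refl; ⊆-trans; xs⊆x∷xs; Any-resp-⊆)
open import Relation.Binary.PropositionalEquality using (_≡_; refl; sym; trans; subst)

<+⇒≤+pred : ∀ {γ} → 0 < γ → ∀ {s a} → s < a + γ → s ≤ a + (γ ∸ 1)
<+⇒≤+pred {suc k} _ {s} {a} s<a+γ = s≤s⁻¹ (subst (s <_) (+-suc a k) s<a+γ)

≤+pred⇒<+ : ∀ {γ} → 0 < γ → ∀ {s a} → s ≤ a + (γ ∸ 1) → s < a + γ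
≤+pred⇒<+ {suc k} _ {s} {a} s≤a+k = subst (s <_) (sym (+-suc a k)) (s≤s s≤a+k)

module _ (γ : ℕ) (L : LinkStream) where
  open LinkStream L using (n)

  lastInstant : GEdge γ L → ℕ
  lastInstant g = start g + (γ ∸ 1)

  EndpointOf : GEdge γ L → Fin n → Set
  EndpointOf g w = w ≡ u g ⊎ w ≡ v g

  MeetsBot : List (GEdge γ L) → GEdge γ L → Set
  MeetsBot R g = ∃[ x ] (Bot γ L R x × Contains γ L g x)

  Contains-lastInstant : 0 < γ → ∀ g {w} → EndpointOf g w →
                         Contains γ L g (lastInstant g , w)
  Contains-lastInstant γ>0 g w∈g = (m≤m+n _ _ , ≤+pred⇒<+ γ>0 ≤-refl) , w∈g

  Contains-lastInstant-of-earlier :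
    0 < γ → ∀ g h {s w} → start h ≤ start g →
    Contains γ L h (s , w) → Contains γ L g (s , w) →
    Contains γ L g (lastInstant h , w)
  Contains-lastInstant-of-earlier γ>0 _ _ h≤g ((_ , s<h+γ) , _) ((g≤s , _) , w∈g) =
    ( ≤-trans g≤s (<+⇒≤+pred γ>0 s<h+γ)
    , ≤+pred⇒<+ γ>0 (+-monoˡ-≤ (γ ∸ 1) h≤g) ) , w∈g

  ∈⇒Bot-lastInstant : ∀ {R h w} → h ∈ R → EndpointOf h w → Bot γ L R (lastInstant h , w)
  ∈⇒Bot-lastInstant h∈R w∈h = Any.map (λ { refl → refl , w∈h }) h∈R

  ∈⇒MeetsBot : 0 < γ → ∀ {R g} → g ∈ R → MeetsBot R g
  ∈⇒MeetsBot γ>0 {g = g} g∈R =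
    _ , ∈⇒Bot-lastInstant g∈R (inj₁ refl) , Contains-lastInstant γ>0 g (inj₁ refl)

  MeetsBot-mono : ∀ {M R g} → M ⊆ R → MeetsBot M g → MeetsBot R g
  MeetsBot-mono M⊆R (x , x∈bot , g∋x) = x , Any-resp-⊆ M⊆R x∈bot , g∋x

  Blocked⇒MeetsBot : 0 < γ → ∀ {M g} → (∀ {h} → h ∈ M → start h ≤ start g) →
                     Blocked γ L M g → MeetsBot M g
  Blocked⇒MeetsBot γ>0 {g = g} earlier (_ , g∋x , M∋x) with find M∋x
  ... | h , h∈M , h∋x =
    _ , ∈⇒Bot-lastInstant h∈M (proj₂ h∋x)
      , Contains-lastInstant-of-earlier γ>0 g h (earlier h∈M) h∋x g∋x

  GreedyRun⇒⊆ : ∀ {P M R} → GreedyRun γ L P M R → M ⊆ R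
  GreedyRun⇒⊆ done        = ⊆-refl
  GreedyRun⇒⊆ (add _ run) = ⊆-trans (xs⊆x∷xs _ _) (GreedyRun⇒⊆ run)
  GreedyRun⇒⊆ (skip _ run) = GreedyRun⇒⊆ run

  GreedyRun⇒MeetsBot :
    0 < γ → ∀ {P M R} → GreedyRun γ L P M R →
    (∀ {h} → h ∈ M → All (λ g → start h ≤ start g) P) →
    AllPairs (λ g h → start g ≤ start h) P →
    ∀ {g} → g ∈ P → MeetsBot R g
  GreedyRun⇒MeetsBot γ>0 (add _ run) _ _ (here refl) =
    ∈⇒MeetsBot γ>0 (GreedyRun⇒⊆ run (here refl))
  GreedyRun⇒MeetsBot γ>0 {g ∷ _} (skip blocked run) M≤P _ (here refl) =
    MeetsBot-mono {g = g} (GreedyRun⇒⊆ run)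
      (Blocked⇒MeetsBot γ>0 {g = g} (All.head ∘ M≤P) blocked)
  GreedyRun⇒MeetsBot γ>0 {g ∷ _} (add _ run) M≤P sorted (there g'∈P) =
    GreedyRun⇒MeetsBot γ>0 run g∷M≤P (AllPairs.tail sorted) g'∈P
    where
    g∷M≤P : ∀ {h} → h ∈ g ∷ _ → All (λ g' → start h ≤ start g') _
    g∷M≤P (here refl) = AllPairs.head sorted
    g∷M≤P (there h∈M) = All.tail (M≤P h∈M)
  GreedyRun⇒MeetsBot γ>0 (skip _ run) M≤P sorted (there g'∈P) =
    GreedyRun⇒MeetsBot γ>0 run (All.tail ∘ M≤P) (AllPairs.tail sorted) g'∈P

  SameGEdge-EndpointOf : ∀ g g' {w} → SameGEdge γ L g g' → EndpointOf g' w → EndpointOf g w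
  SameGEdge-EndpointOf _ _ (_ , inj₁ (u≡u' , _)) (inj₁ w≡u') = inj₁ (trans w≡u' (sym u≡u'))
  SameGEdge-EndpointOf _ _ (_ , inj₁ (_ , v≡v')) (inj₂ w≡v') = inj₂ (trans w≡v' (sym v≡v'))
  SameGEdge-EndpointOf _ _ (_ , inj₂ (_ , v≡u')) (inj₁ w≡u') = inj₂ (trans w≡u' (sym v≡u'))
  SameGEdge-EndpointOf _ _ (_ , inj₂ (u≡v' , _)) (inj₂ w≡v') = inj₁ (trans w≡v' (sym u≡v'))

  SameGEdge-MeetsBot : ∀ {R g g'} → SameGEdge γ L g g' → MeetsBot R g' → MeetsBot R g
  SameGEdge-MeetsBot {g = g} {g'} same@(refl , _) (x , x∈bot , (during , w∈g')) =
    x , x∈bot , during , SameGEdge-EndpointOf g g' same w∈g'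

lemma2 : (γ : ℕ) → 0 < γ → (L : LinkStream) → (M M' : List (GEdge γ L)) →
    GreedyOutput γ L M → IsMatching γ L M' →
    ∀ {g} → g ∈ M' → ∃[ x ] (Bot γ L M x × Contains γ L g x)
lemma2 γ γ>0 L M M' (P , (_ , P-complete , _ , P-sorted) , run) (M'⊆E , _) {g} g∈M'
  with find (P-complete g (M'⊆E g∈M'))
... | g' , g'∈P , same =
  SameGEdge-MeetsBot γ L {M} {g} {g'} same
    (GreedyRun⇒MeetsBot γ L γ>0 run (λ ()) P-sorted g'∈P)
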